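{- Let $k\ge 4$ and let $G_k$, $G_{k+1}$ be the graphs defined below (for $\ell=2$). Define $\chi(0)=0$ and $\chi(m)=m+3\cdot 2^{k-2}$ for $IV_b^k\le m\le IV_t^k$. Then $\chi$ is a bijection from the nodes of $B_4$ of $G_k$ onto the nodes of $B_3$ of $G_{k+1}$; for every edge of $B_4$ of $G_k$ other than the red edge from $0$ to $IV_b^k$, its image under $\chi$ is an edge of $B_3$ of $G_{k+1}$ of the same color, and every edge of $B_3$ of $G_{k+1}$ arises in this way. Moreover, in $G_{k+1}$ the node $III_b^{k+1}$ has a red edge from $IV_b^{k+1}$ (instead of from $0$) and a blue edge from $IV_t^{k+1}$.
   Context: The pruning function $\operatorname{P}_{2}:\mathbb{Z}_{>0}\to\mathbb{Z}_{\geq 0}$: write $m$ in binary, padded on the left with zeros as needed, let $z$ be the position (position $0$ = least significant bit) of the second zero bit counted from the right, let $q = 2^{z}\lfloor m/2^{z}\rfloor$, and set $\operatorname{P}_2(m)=\max(q-1,0)$. For an integer $k\ge 2$, $G_k$ is the directed graph with node set $\{0\}\cup\{2^{k-1}-1,\ldots,2^k-1\}$ and edges: for each $m$ with $2^{k-1}-1\le m<2^k-1$, a "blue" edge from $m$ to $m+1$ (weight $-1$) and a "red" edge from $\operatorname{P}_2(m)$ to $m$ (weight $+1$). For $k\ge 4$ set $I_t^k=2^k-1$, $I_b^k=2^k-2^{k-2}-1$, $II_t^k=2^k-2^{k-2}-2$, $II_b^k=2^k-2^{k-2}-2^{k-4}-1$, $III_t^k=2^k-2^{k-2}-2^{k-4}-2$,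 $III_b^k=2^k-2^{k-2}-2^{k-3}-1$, $IV_t^k=2^k-2^{k-2}-2^{k-3}-2$, $IV_b^k=2^{k-1}-1$. For $X\in\{I,II,III,IV\}$, the box $B_j$ ($j=1,2,3,4$ respectively) of $G_k$ is the induced subgraph of $G_k$ on $\{0\}\cup\{X_b^k,\ldots,X_t^k\}$. -}

module Defs where

open import Data.Nat using (ℕ; zero; suc; _+_; _*_; _∸_; _^_; _≤_; _<_)
open import Data.Nat.DivMod using (_/_; _%_)
open import Data.Bool using (if_then_else_)
open import Data.Nat using (_≡ᵇ_)
open import Data.Product using (_×_)
open import Data.Sum using (_⊎_)
open import Relation.Binary.PropositionalEquality using (_≡_)

-- Position (0 = least significant bit) of the first zero bit of m,
-- computed with fuel (fuel ≥ m+1 always suffices).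
firstZeroF : ℕ → ℕ → ℕ
firstZeroF zero    m = 0
firstZeroF (suc f) m = if (m % 2) ≡ᵇ 0 then 0 else suc (firstZeroF f (m / 2))

firstZero : ℕ → ℕ
firstZero m = firstZeroF (suc m) m

shiftR : ℕ → ℕ → ℕ
shiftR zero    m = m
shiftR (suc n) m = shiftR n (m / 2)

secondZero : ℕ → ℕ
secondZero m = z₁ + 1 + firstZero (shiftR (z₁ + 1) m)
  where z₁ = firstZero m

P₂ : ℕ → ℕ
P₂ m = (2 ^ z * shiftR z m) ∸ 1
  where z = secondZero m

data Color : Set where
  blue red : Color

IsNode : ℕ → ℕ → Set
IsNode k n = n ≡ 0 ⊎ (2 ^ (k ∸ 1) ∸ 1 ≤ n × n ≤ 2 ^ k ∸ 1)

data Edge (k : ℕ) : Color → ℕ → ℕ → Set where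
  blueE : ∀ m v → 2 ^ (k ∸ 1) ∸ 1 ≤ m → m < 2 ^ k ∸ 1 → v ≡ suc m → Edge k blue m v
  redE  : ∀ m u → 2 ^ (k ∸ 1) ∸ 1 ≤ m → m < 2 ^ k ∸ 1 → u ≡ P₂ m → Edge k red u m

data BoxName : Set where
  I II III IV : BoxName

top bot : ℕ → BoxName → ℕ
top k I   = 2 ^ k ∸ 1
top k II  = 2 ^ k ∸ 2 ^ (k ∸ 2) ∸ 2
top k III = 2 ^ k ∸ 2 ^ (k ∸ 2) ∸ 2 ^ (k ∸ 4) ∸ 2
top k IV  = 2 ^ k ∸ 2 ^ (k ∸ 2) ∸ 2 ^ (k ∸ 3) ∸ 2
bot k I   = 2 ^ k ∸ 2 ^ (k ∸ 2) ∸ 1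
bot k II  = 2 ^ k ∸ 2 ^ (k ∸ 2) ∸ 2 ^ (k ∸ 4) ∸ 1
bot k III = 2 ^ k ∸ 2 ^ (k ∸ 2) ∸ 2 ^ (k ∸ 3) ∸ 1
bot k IV  = 2 ^ (k ∸ 1) ∸ 1

InBox : ℕ → BoxName → ℕ → Set
InBox k X n = n ≡ 0 ⊎ (bot k X ≤ n × n ≤ top k X)

BoxEdge : ℕ → BoxName → Color → ℕ → ℕ → Set
BoxEdge k X c u v = Edge k c u v × InBox k X u × InBox k X v

χ : ℕ → ℕ → ℕ
χ k zero    = 0
χ k (suc m) = suc m + 3 * 2 ^ (k ∸ 2)

-- Write k = i + 4 and N = 2^i.  Then B₄ of G_k is {0} ∪ [8N-1, 10N-2], B₃ of G_{k+1} is
-- {0} ∪ [20N-1, 22N-2], and χ shifts the first interval onto the second.  For red edges, P₂ only reads the bits of m up to its second zero: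
-- if r + 1 < 2^j, then P₂ (2^j·2h + r) = 2^j·2h + q(r) - 1.  With j = i + 1, both
-- 8N = 2^j·4 and 20N = 2^j·10 have this shape, and the red edge into offset s + 1 of either
-- box has s + 1 ≤ 2N - 1 < 2^j; hence P₂ (8N-1 + (s+1)) and P₂ (20N-1 + (s+1)) lie at the
-- same offset q(s) in their boxes.  Only the bottoms differ: P₂ (8N-1) = 0, whereas
-- P₂ (20N-1) = 16N-1 = IV_b^{k+1}.

module Submission where

open import Defs
open import Data.Nat
open import Data.Nat.Properties
open import Data.Nat.DivMod
open import Data.Nat.Divisibility using (divides-refl)
open import Data.Nat.Tactic.RingSolver using (solve-∀; solve)
open import Data.List using (_∷_; [])
open import Data.Product using (Σ; ∃; ∃₂; _×_; _,_)
open import Data.Sum using (_⊎_; inj₁; inj₂)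
open import Data.Empty using (⊥-elim)
open import Relation.Binary.PropositionalEquality
open import Relation.Nullary using (¬_)

m+o≡n⇒m≤n : ∀ {m n} o → m + o ≡ n → m ≤ n
m+o≡n⇒m≤n {m} o refl = m≤m+n m o

m≡o+n⇒m∸n≡o : ∀ {m n o} → m ≡ o + n → m ∸ n ≡ o
m≡o+n⇒m∸n≡o {n = n} {o} refl = m+n∸n≡m o n

data Halves : ℕ → Set where
  even : ∀ y → Halves (2 * y)
  odd  : ∀ y → Halves (suc (2 * y))

halves : ∀ n → Halves n
halves zero    = even 0
halves (suc n) with halves n
... | even y = odd y
... | odd y  = subst Halves (*-suc 2 y) (even (suc y))

half-< : ∀ {y m} → suc (2 * y) < 2 * m → y < m
half-< {y} {m} h = *-cancelˡ-≤ 2 (subst (_≤ 2 * m) (sym (*-suc 2 y)) h)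

-- The binary expansion of ones z b is that of b followed by z ones: ones z b = 2^z (b + 1) - 1.
ones : ℕ → ℕ → ℕ
ones zero    b = b
ones (suc z) b = suc (2 * ones z b)

suc-ones : ∀ z b → suc (ones z b) ≡ 2 ^ z * suc b
suc-ones zero    b = sym (*-identityˡ (suc b))
suc-ones (suc z) b = begin
  suc (suc (2 * ones z b)) ≡⟨ *-suc 2 (ones z b) ⟨
  2 * suc (ones z b)       ≡⟨ cong (2 *_) (suc-ones z b) ⟩
  2 * (2 ^ z * suc b)      ≡⟨ *-assoc 2 (2 ^ z) (suc b) ⟨
  2 ^ suc z * suc b        ∎
  where open ≡-Reasoning

ones-+ : ∀ z b c → ones z b + 2 ^ z * c ≡ ones z (b + c)
ones-+ z b c = suc-injective (begin
  suc (ones z b) + 2 ^ z * c   ≡⟨ cong (_+ 2 ^ z * c) (suc-ones z b) ⟩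
  2 ^ z * suc b + 2 ^ z * c    ≡⟨ *-distribˡ-+ (2 ^ z) (suc b) c ⟨
  2 ^ z * suc (b + c)          ≡⟨ suc-ones z (b + c) ⟨
  suc (ones z (b + c))         ∎)
  where open ≡-Reasoning

even%2 : ∀ x → 2 * x % 2 ≡ 0
even%2 x = trans (cong (_% 2) (*-comm 2 x)) (m*n%n≡0 x 2)

odd%2 : ∀ x → suc (2 * x) % 2 ≡ 1
odd%2 x = trans (cong (λ y → suc y % 2) (*-comm 2 x)) ([m+kn]%n≡m%n 1 x 2)

even/2 : ∀ x → 2 * x / 2 ≡ x
even/2 x = trans (cong (_/ 2) (*-comm 2 x)) (m*n/n≡m x 2)

odd/2 : ∀ x → suc (2 * x) / 2 ≡ x
odd/2 x = trans (cong (λ y → suc y / 2) (*-comm 2 x))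
                (trans (+-distrib-/-∣ʳ 1 {d = 2} (divides-refl x)) (m*n/n≡m x 2))

firstZeroF-ones : ∀ z a f → z < f → firstZeroF f (ones z (2 * a)) ≡ z
firstZeroF-ones zero    a (suc f) _ rewrite even%2 a = refl
firstZeroF-ones (suc z) a (suc f) (s≤s z<f)
  rewrite odd%2 (ones z (2 * a)) | odd/2 (ones z (2 * a)) = cong suc (firstZeroF-ones z a f z<f)

z≤ones : ∀ z b → z ≤ ones z b
z≤ones zero    b = z≤n
z≤ones (suc z) b = s≤s (≤-trans (z≤ones z b) (m≤m+n (ones z b) _))

firstZero-ones : ∀ z a → firstZero (ones z (2 * a)) ≡ z
firstZero-ones z a = firstZeroF-ones z a _ (s≤s (z≤ones z (2 * a)))

shiftR-+ : ∀ m n x → shiftR (m + n) x ≡ shiftR n (shiftR m x)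
shiftR-+ zero    n x = refl
shiftR-+ (suc m) n x = shiftR-+ m n (x / 2)

shiftR-ones : ∀ z b → shiftR z (ones z b) ≡ b
shiftR-ones zero    b = refl
shiftR-ones (suc z) b rewrite odd/2 (ones z b) = shiftR-ones z b

shiftR-suc-ones : ∀ z a → shiftR (z + 1) (ones z (2 * a)) ≡ a
shiftR-suc-ones z a = begin
  shiftR (z + 1) (ones z (2 * a)) ≡⟨ shiftR-+ z 1 _ ⟩
  shiftR z (ones z (2 * a)) / 2   ≡⟨ cong (_/ 2) (shiftR-ones z (2 * a)) ⟩
  2 * a / 2                       ≡⟨ even/2 a ⟩
  a                               ∎
  where open ≡-Reasoning

secondZero-ones : ∀ z₁ z₂ a → secondZero (ones z₁ (2 * ones z₂ (2 * a))) ≡ z₁ + 1 + z₂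
secondZero-ones z₁ z₂ a
  rewrite firstZero-ones z₁ (ones z₂ (2 * a))
        | shiftR-suc-ones z₁ (ones z₂ (2 * a))
        | firstZero-ones z₂ a = refl

q₂ : ℕ → ℕ
q₂ m = 2 ^ secondZero m * shiftR (secondZero m) m

q₂-ones : ∀ z₁ z₂ a → q₂ (ones z₁ (2 * ones z₂ (2 * a))) ≡ 2 ^ z₁ * (2 * (2 ^ z₂ * (2 * a)))
q₂-ones z₁ z₂ a rewrite secondZero-ones z₁ z₂ a = begin
  2 ^ (z₁ + 1 + z₂) * shiftR (z₁ + 1 + z₂) m       ≡⟨ cong (2 ^ (z₁ + 1 + z₂) *_) shifted ⟩
  2 ^ (z₁ + 1 + z₂) * (2 * a)                       ≡⟨ cong (_* (2 * a)) (^-distribˡ-+-* 2 (z₁ + 1) z₂) ⟩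
  2 ^ (z₁ + 1) * 2 ^ z₂ * (2 * a)                   ≡⟨ cong (λ p → p * 2 ^ z₂ * (2 * a)) (^-distribˡ-+-* 2 z₁ 1) ⟩
  2 ^ z₁ * 2 * 2 ^ z₂ * (2 * a)                     ≡⟨ reassoc (2 ^ z₁) (2 ^ z₂) a ⟩
  2 ^ z₁ * (2 * (2 ^ z₂ * (2 * a)))                 ∎
  where
  open ≡-Reasoning
  m = ones z₁ (2 * ones z₂ (2 * a))
  reassoc : ∀ A B a → A * 2 * B * (2 * a) ≡ A * (2 * (B * (2 * a)))
  reassoc = solve-∀
  shifted : shiftR (z₁ + 1 + z₂) m ≡ 2 * a
  shifted = begin
    shiftR (z₁ + 1 + z₂) m          ≡⟨ shiftR-+ (z₁ + 1) z₂ m ⟩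
    shiftR z₂ (shiftR (z₁ + 1) m)   ≡⟨ cong (shiftR z₂) (shiftR-suc-ones z₁ (ones z₂ (2 * a))) ⟩
    shiftR z₂ (ones z₂ (2 * a))     ≡⟨ shiftR-ones z₂ (2 * a) ⟩
    2 * a                           ∎

<2^⇒ones : ∀ i x → x < 2 ^ i → ∃₂ λ z a → ∃ λ d → z + d ≡ i × x ≡ ones z (2 * a)
<2^⇒ones i       x       x<2^i with halves x
<2^⇒ones i       .(2 * y)       _             | even y = 0 , y , i , refl , refl
<2^⇒ones zero    .(suc (2 * y)) (s≤s ())      | odd y
<2^⇒ones (suc i) .(suc (2 * y)) x<2^i         | odd y with <2^⇒ones i y (half-< x<2^i)
... | z , a , d , refl , refl = suc z , a , d , refl , refl

suc<2^⇒ones² : ∀ j r → suc r < 2 ^ j →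
  ∃₂ λ z₁ z₂ → ∃₂ λ a d → z₁ + suc (z₂ + d) ≡ j × r ≡ ones z₁ (2 * ones z₂ (2 * a))
suc<2^⇒ones² j r r+1<2^j with <2^⇒ones j r (<-trans (n<1+n r) r+1<2^j)
... | z₁ , y , d₁ , refl , refl = z₁ , second d₁ (*-cancelˡ-< (2 ^ z₁) _ _ low)
  where
  low : 2 ^ z₁ * suc (2 * y) < 2 ^ z₁ * 2 ^ d₁
  low = subst₂ _<_ (suc-ones z₁ (2 * y)) (^-distribˡ-+-* 2 z₁ d₁) r+1<2^j
  second : ∀ d₁ → suc (2 * y) < 2 ^ d₁ →
    ∃₂ λ z₂ a → ∃ λ d → z₁ + suc (z₂ + d) ≡ z₁ + d₁ × ones z₁ (2 * y) ≡ ones z₁ (2 * ones z₂ (2 * a))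
  second zero    (s≤s ())
  second (suc d₁) h with <2^⇒ones d₁ y (half-< h)
  ... | z₂ , a , d , refl , refl = z₂ , a , d , refl , refl

ones²-+ : ∀ z₁ z₂ a c →
  ones z₁ (2 * ones z₂ (2 * a)) + 2 ^ z₁ * (2 * (2 ^ z₂ * (2 * c))) ≡ ones z₁ (2 * ones z₂ (2 * (a + c)))
ones²-+ z₁ z₂ a c = begin
  ones z₁ (2 * ones z₂ (2 * a)) + 2 ^ z₁ * (2 * (2 ^ z₂ * (2 * c)))
    ≡⟨ ones-+ z₁ _ _ ⟩
  ones z₁ (2 * ones z₂ (2 * a) + 2 * (2 ^ z₂ * (2 * c)))
    ≡⟨ cong (ones z₁) (*-distribˡ-+ 2 (ones z₂ (2 * a)) (2 ^ z₂ * (2 * c))) ⟨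
  ones z₁ (2 * (ones z₂ (2 * a) + 2 ^ z₂ * (2 * c)))
    ≡⟨ cong (λ x → ones z₁ (2 * x)) (ones-+ z₂ _ _) ⟩
  ones z₁ (2 * ones z₂ (2 * a + 2 * c))
    ≡⟨ cong (λ x → ones z₁ (2 * ones z₂ x)) (*-distribˡ-+ 2 a c) ⟨
  ones z₁ (2 * ones z₂ (2 * (a + c)))
    ∎
  where open ≡-Reasoning

-- Bit j of 2^j·2h is zero, so the two lowest zero bits of the sum are those of r.
q₂-high : ∀ j h r → suc r < 2 ^ j → q₂ (2 ^ j * (2 * h) + r) ≡ 2 ^ j * (2 * h) + q₂ r
q₂-high j h r r+1<2^j with suc<2^⇒ones² j r r+1<2^j
... | z₁ , z₂ , a , d , refl , refl = begin
  q₂ (2 ^ j * (2 * h) + ones z₁ (2 * ones z₂ (2 * a)))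
    ≡⟨ cong (λ p → q₂ (p * (2 * h) + ones z₁ (2 * ones z₂ (2 * a)))) pow ⟩
  q₂ (A * (2 * (B * D)) * (2 * h) + ones z₁ (2 * ones z₂ (2 * a)))
    ≡⟨ cong q₂ (move A B D h _) ⟩
  q₂ (ones z₁ (2 * ones z₂ (2 * a)) + A * (2 * (B * (2 * (D * h)))))
    ≡⟨ cong q₂ (ones²-+ z₁ z₂ a (D * h)) ⟩
  q₂ (ones z₁ (2 * ones z₂ (2 * (a + D * h))))
    ≡⟨ q₂-ones z₁ z₂ (a + D * h) ⟩
  A * (2 * (B * (2 * (a + D * h))))
    ≡⟨ expand A B D h a ⟩
  A * (2 * (B * D)) * (2 * h) + A * (2 * (B * (2 * a)))
    ≡⟨ cong₂ (λ p x → p * (2 * h) + x) pow (q₂-ones z₁ z₂ a) ⟨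
  2 ^ j * (2 * h) + q₂ (ones z₁ (2 * ones z₂ (2 * a)))
    ∎
  where
  open ≡-Reasoning
  A = 2 ^ z₁
  B = 2 ^ z₂
  D = 2 ^ d
  pow : 2 ^ j ≡ A * (2 * (B * D))
  pow = trans (^-distribˡ-+-* 2 z₁ (suc (z₂ + d))) (cong (λ p → A * (2 * p)) (^-distribˡ-+-* 2 z₂ d))
  move : ∀ A B D h x → A * (2 * (B * D)) * (2 * h) + x ≡ x + A * (2 * (B * (2 * (D * h))))
  move = solve-∀
  expand : ∀ A B D h a → A * (2 * (B * (2 * (a + D * h)))) ≡ A * (2 * (B * D)) * (2 * h) + A * (2 * (B * (2 * a)))
  expand = solve-∀

q₂-≤ : ∀ j r → suc r < 2 ^ j → q₂ r ≤ r
q₂-≤ j r r+1<2^j with suc<2^⇒ones² j r r+1<2^j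
... | z₁ , z₂ , a , d , refl , refl =
  subst₂ _≤_ (sym (q₂-ones z₁ z₂ a)) (ones²-+ z₁ z₂ 0 a) (m≤n+m _ (ones z₁ (2 * ones z₂ 0)))

P₂-offset : ∀ j h b r → 2 ^ j * (2 * h) ≡ suc b → suc r < 2 ^ j → P₂ (b + suc r) ≡ b + q₂ r
P₂-offset j h b r aligned r+1<2^j = begin
  q₂ (b + suc r) ∸ 1                  ≡⟨ cong (λ x → q₂ x ∸ 1) (trans (+-suc b r) (cong (_+ r) (sym aligned))) ⟩
  q₂ (2 ^ j * (2 * h) + r) ∸ 1        ≡⟨ cong (_∸ 1) (q₂-high j h r r+1<2^j) ⟩
  2 ^ j * (2 * h) + q₂ r ∸ 1          ≡⟨ cong (λ x → x + q₂ r ∸ 1) aligned ⟩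
  b + q₂ r                            ∎
  where open ≡-Reasoning

P₂-ones-0 : ∀ z → P₂ (ones z 0) ≡ 0
P₂-ones-0 z = cong (_∸ 1) (trans (q₂-ones z 0 0) (*-zeroʳ (2 ^ z)))

P₂-ones-4 : ∀ z → P₂ (ones z 4) ≡ 2 ^ z * 4 ∸ 1
P₂-ones-4 z = cong (_∸ 1) (q₂-ones z 0 1)

OffsetNode : ℕ → ℕ → ℕ → Set
OffsetNode b w n = n ≡ 0 ⊎ ∃ λ t → t ≤ w × n ≡ b + t

inBox⇒offset : ∀ k X {b w n} → bot k X ≡ b → top k X ≡ b + w → InBox k X n → OffsetNode b w n
inBox⇒offset _ _ _ _ (inj₁ n≡0) = inj₁ n≡0
inBox⇒offset k X refl top≡ (inj₂ (b≤n , n≤top)) with m≤n⇒∃[o]m+o≡n b≤n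
... | t , refl = inj₂ (t , +-cancelˡ-≤ (bot k X) t _ (subst (bot k X + t ≤_) top≡ n≤top) , refl)

offset⇒inBox : ∀ k X {b w n} → bot k X ≡ b → top k X ≡ b + w → OffsetNode b w n → InBox k X n
offset⇒inBox _ _ _ _ (inj₁ n≡0) = inj₁ n≡0
offset⇒inBox k X refl top≡ (inj₂ (t , t≤w , refl)) =
  inj₂ (m≤m+n (bot k X) t , subst (bot k X + t ≤_) (sym top≡) (+-monoʳ-≤ (bot k X) t≤w))

-- Edges of a box of width w in offsets from its bottom, except the red edge into the bottom;
-- B₄ of G_k and B₃ of G_{k+1} share this structure.
data Step (w : ℕ) : Color → ℕ → ℕ → Set where
  blueStep : ∀ {t} → t < w → Step w blue t (suc t)
  redStep  : ∀ {s} → s < w → Step w red (q₂ s) (suc s)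

module OffsetBox (k : ℕ) (X : BoxName) (b w j h : ℕ)
  (bot≡    : bot k X ≡ b)
  (top≡    : top k X ≡ b + w)
  (lo-pos  : 0 < 2 ^ (k ∸ 1) ∸ 1)
  (lo≤b    : 2 ^ (k ∸ 1) ∸ 1 ≤ b)
  (b+w<hi  : b + w < 2 ^ k ∸ 1)
  (w<2^j   : w < 2 ^ j)
  (aligned : 2 ^ j * (2 * h) ≡ suc b)
  where

  prune : ∀ {s} → s < w → P₂ (b + suc s) ≡ b + q₂ s
  prune {s} s<w = P₂-offset j h b s aligned (≤-<-trans s<w w<2^j)

  step-bounded : ∀ {c t t′} → Step w c t t′ → t ≤ w × t′ ≤ w
  step-bounded (blueStep t<w)    = <⇒≤ t<w , t<w
  step-bounded (redStep {s} s<w) = ≤-trans (q₂-≤ j s (≤-<-trans s<w w<2^j)) (<⇒≤ s<w) , s<w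

  step⇒edge : ∀ {c t t′} → Step w c t t′ → Edge k c (b + t) (b + t′)
  step⇒edge (blueStep {t} t<w) =
    blueE (b + t) (b + suc t) (≤-trans lo≤b (m≤m+n b t)) (≤-<-trans (+-monoʳ-≤ b (<⇒≤ t<w)) b+w<hi) (+-suc b t)
  step⇒edge (redStep {s} s<w) =
    redE (b + suc s) (b + q₂ s) (≤-trans lo≤b (m≤m+n b (suc s))) (≤-<-trans (+-monoʳ-≤ b s<w) b+w<hi) (sym (prune s<w))

  step⇒boxEdge : ∀ {c t t′} → Step w c t t′ → BoxEdge k X c (b + t) (b + t′)
  step⇒boxEdge st with step-bounded st
  ... | t≤w , t′≤w =
    step⇒edge st , offset⇒inBox k X bot≡ top≡ (inj₂ (_ , t≤w , refl)) , offset⇒inBox k X bot≡ top≡ (inj₂ (_ , t′≤w , refl))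

  red-into-bot : Edge k red (P₂ b) b
  red-into-bot = redE b (P₂ b) lo≤b (≤-<-trans (m≤m+n b w) b+w<hi) refl

  StepAt : Color → ℕ → ℕ → Set
  StepAt c u v = ∃₂ λ t t′ → Step w c t t′ × u ≡ b + t × v ≡ b + t′

  edge⇒step : ∀ {c u v} → Edge k c u v → OffsetNode b w u → OffsetNode b w v →
    StepAt c u v ⊎ (c ≡ red × u ≡ P₂ b × v ≡ b)
  edge⇒step (blueE m _ lo≤m _ refl) (inj₁ refl) _ = ⊥-elim (<⇒≱ lo-pos lo≤m)
  edge⇒step (blueE m _ _ _ refl) (inj₂ _) (inj₁ ())
  edge⇒step (blueE m _ _ _ refl) (inj₂ (t , _ , refl)) (inj₂ (t′ , t′≤w , 1+b+t≡b+t′)) =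
    inj₁ (t , suc t , blueStep (subst (_≤ w) t′≡1+t t′≤w) , refl , trans 1+b+t≡b+t′ (cong (b +_) t′≡1+t))
    where
    t′≡1+t : t′ ≡ suc t
    t′≡1+t = +-cancelˡ-≡ b t′ (suc t) (trans (sym 1+b+t≡b+t′) (sym (+-suc b t)))
  edge⇒step (redE m _ lo≤m _ _) _ (inj₁ refl) = ⊥-elim (<⇒≱ lo-pos lo≤m)
  edge⇒step (redE m _ _ _ u≡P₂m) _ (inj₂ (zero , _ , m≡b+0)) =
    inj₂ (refl , trans u≡P₂m (cong P₂ m≡b) , m≡b)
    where m≡b : m ≡ b
          m≡b = trans m≡b+0 (+-identityʳ b)
  edge⇒step (redE m _ _ _ u≡P₂m) _ (inj₂ (suc s , s<w , refl)) =
    inj₁ (q₂ s , suc s , redStep s<w , trans u≡P₂m (prune s<w) , refl)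

  boxEdge⇒step : ∀ {c u v} → BoxEdge k X c u v → StepAt c u v ⊎ (c ≡ red × u ≡ P₂ b × v ≡ b)
  boxEdge⇒step (e , u∈X , v∈X) = edge⇒step e (inBox⇒offset k X bot≡ top≡ u∈X) (inBox⇒offset k X bot≡ top≡ v∈X)

χ-injective : ∀ k m n → χ k m ≡ χ k n → m ≡ n
χ-injective k zero    zero    _ = refl
χ-injective k (suc m) (suc n) e = +-cancelʳ-≡ (3 * 2 ^ (k ∸ 2)) (suc m) (suc n) e

-- k = 4 + i and N = 2^i = g + 1: the bottoms IV_b^k, IV_b^{k+1}, III_b^{k+1} are 8N-1, 16N-1, 20N-1,
-- and both B₄ of G_k and B₃ of G_{k+1} have width 2N-1.
module Level (i g : ℕ) (2^i≡1+g : 2 ^ i ≡ suc g) where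
  k : ℕ
  k = 4 + i

  bot-IV≡ : bot k IV ≡ 8 * g + 7
  bot-IV≡ = m≡o+n⇒m∸n≡o pow
    where pow : 2 ^ (k ∸ 1) ≡ 8 * g + 7 + 1
          pow rewrite 2^i≡1+g = solve (g ∷ [])

  top-IV≡ : top k IV ≡ 8 * g + 7 + (2 * g + 1)
  top-IV≡ = m≡o+n⇒m∸n≡o (m≡o+n⇒m∸n≡o (m≡o+n⇒m∸n≡o pow))
    where pow : 2 ^ k ≡ 8 * g + 7 + (2 * g + 1) + 2 + 2 ^ (k ∸ 3) + 2 ^ (k ∸ 2)
          pow rewrite 2^i≡1+g = solve (g ∷ [])

  bot-IV′≡ : bot (suc k) IV ≡ 16 * g + 15
  bot-IV′≡ = m≡o+n⇒m∸n≡o pow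
    where pow : 2 ^ k ≡ 16 * g + 15 + 1
          pow rewrite 2^i≡1+g = solve (g ∷ [])

  top-IV′≡ : top (suc k) IV ≡ 20 * g + 18
  top-IV′≡ = m≡o+n⇒m∸n≡o (m≡o+n⇒m∸n≡o (m≡o+n⇒m∸n≡o pow))
    where pow : 2 ^ suc k ≡ 20 * g + 18 + 2 + 2 ^ (k ∸ 2) + 2 ^ (k ∸ 1)
          pow rewrite 2^i≡1+g = solve (g ∷ [])

  bot-III′≡ : bot (suc k) III ≡ 20 * g + 19
  bot-III′≡ = m≡o+n⇒m∸n≡o (m≡o+n⇒m∸n≡o (m≡o+n⇒m∸n≡o pow))
    where pow : 2 ^ suc k ≡ 20 * g + 19 + 1 + 2 ^ (k ∸ 2) + 2 ^ (k ∸ 1)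
          pow rewrite 2^i≡1+g = solve (g ∷ [])

  top-III′≡ : top (suc k) III ≡ 20 * g + 19 + (2 * g + 1)
  top-III′≡ = m≡o+n⇒m∸n≡o (m≡o+n⇒m∸n≡o (m≡o+n⇒m∸n≡o pow))
    where pow : 2 ^ suc k ≡ 20 * g + 19 + (2 * g + 1) + 2 + 2 ^ (k ∸ 3) + 2 ^ (k ∸ 1)
          pow rewrite 2^i≡1+g = solve (g ∷ [])

  hi′≡ : 2 ^ suc k ∸ 1 ≡ 32 * g + 31
  hi′≡ = m≡o+n⇒m∸n≡o pow
    where pow : 2 ^ suc k ≡ 32 * g + 31 + 1
          pow rewrite 2^i≡1+g = solve (g ∷ [])

  χ-offset : ∀ t → χ k (8 * g + 7 + t) ≡ 20 * g + 19 + t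
  χ-offset t = trans (cong (χ k) pred-form) pow
    where pred-form : 8 * g + 7 + t ≡ suc (8 * g + 6 + t)
          pred-form = solve (g ∷ t ∷ [])
          pow : χ k (suc (8 * g + 6 + t)) ≡ 20 * g + 19 + t
          pow rewrite 2^i≡1+g = solve (g ∷ t ∷ [])

  P₂-bot-IV : P₂ (8 * g + 7) ≡ 0
  P₂-bot-IV = subst (λ x → P₂ x ≡ 0) (sym bot≡ones) (P₂-ones-0 (3 + i))
    where pow : suc (8 * g + 7) ≡ 2 ^ (3 + i) * 1
          pow rewrite 2^i≡1+g = solve (g ∷ [])
          bot≡ones : 8 * g + 7 ≡ ones (3 + i) 0
          bot≡ones = suc-injective (trans pow (sym (suc-ones (3 + i) 0)))

  P₂-bot-III′ : P₂ (20 * g + 19) ≡ 16 * g + 15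
  P₂-bot-III′ = begin
    P₂ (20 * g + 19)        ≡⟨ cong P₂ bot≡ones ⟩
    P₂ (ones (2 + i) 4)     ≡⟨ P₂-ones-4 (2 + i) ⟩
    2 ^ (2 + i) * 4 ∸ 1     ≡⟨ m≡o+n⇒m∸n≡o pow₄ ⟩
    16 * g + 15             ∎
    where open ≡-Reasoning
          pow₅ : suc (20 * g + 19) ≡ 2 ^ (2 + i) * 5
          pow₅ rewrite 2^i≡1+g = solve (g ∷ [])
          bot≡ones : 20 * g + 19 ≡ ones (2 + i) 4
          bot≡ones = suc-injective (trans pow₅ (sym (suc-ones (2 + i) 4)))
          pow₄ : 2 ^ (2 + i) * 4 ≡ 16 * g + 15 + 1
          pow₄ rewrite 2^i≡1+g = solve (g ∷ [])

  width<2^1+i : 2 * g + 1 < 2 ^ suc i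
  width<2^1+i rewrite 2^i≡1+g = m+o≡n⇒m≤n 0 (solve (g ∷ []))

  bot-IV-aligned : 2 ^ suc i * (2 * 2) ≡ suc (8 * g + 7)
  bot-IV-aligned rewrite 2^i≡1+g = solve (g ∷ [])

  bot-III′-aligned : 2 ^ suc i * (2 * 5) ≡ suc (20 * g + 19)
  bot-III′-aligned rewrite 2^i≡1+g = solve (g ∷ [])

  -- Opaque: otherwise the with-abstractions over IV-box and III-box below normalise these
  -- ring-solver proofs and exhaust memory.
  opaque
    lo-pos : 0 < 2 ^ (k ∸ 1) ∸ 1
    lo-pos = subst (0 <_) (sym bot-IV≡) (m+o≡n⇒m≤n (8 * g + 6) (solve (g ∷ [])))

    IV-below-hi : 8 * g + 7 + (2 * g + 1) < 2 ^ k ∸ 1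
    IV-below-hi = subst (8 * g + 7 + (2 * g + 1) <_) (sym bot-IV′≡) (m+o≡n⇒m≤n (6 * g + 6) (solve (g ∷ [])))

    lo′-pos : 0 < 2 ^ k ∸ 1
    lo′-pos = subst (0 <_) (sym bot-IV′≡) (m+o≡n⇒m≤n (16 * g + 14) (solve (g ∷ [])))

    lo′≤III : 2 ^ k ∸ 1 ≤ 20 * g + 19
    lo′≤III = subst (_≤ 20 * g + 19) (sym bot-IV′≡) (m+o≡n⇒m≤n (4 * g + 4) (solve (g ∷ [])))

    III-below-hi′ : 20 * g + 19 + (2 * g + 1) < 2 ^ suc k ∸ 1
    III-below-hi′ = subst (20 * g + 19 + (2 * g + 1) <_) (sym hi′≡) (m+o≡n⇒m≤n (10 * g + 10) (solve (g ∷ [])))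

  module IV-box = OffsetBox k IV (8 * g + 7) (2 * g + 1) (suc i) 2 bot-IV≡ top-IV≡
    lo-pos (≤-reflexive bot-IV≡) IV-below-hi width<2^1+i bot-IV-aligned

  module III-box = OffsetBox (suc k) III (20 * g + 19) (2 * g + 1) (suc i) 5 bot-III′≡ top-III′≡
    lo′-pos lo′≤III III-below-hi′ width<2^1+i bot-III′-aligned

  χ-maps : ∀ n → InBox k IV n → InBox (suc k) III (χ k n)
  χ-maps n n∈IV with inBox⇒offset k IV bot-IV≡ top-IV≡ n∈IV
  ... | inj₁ refl             = inj₁ refl
  ... | inj₂ (t , t≤w , refl) = offset⇒inBox (suc k) III bot-III′≡ top-III′≡ (inj₂ (t , t≤w , χ-offset t))

  χ-onto : ∀ n′ → InBox (suc k) III n′ → Σ ℕ (λ n → InBox k IV n × χ k n ≡ n′)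
  χ-onto n′ n′∈III with inBox⇒offset (suc k) III bot-III′≡ top-III′≡ n′∈III
  ... | inj₁ refl             = 0 , inj₁ refl , refl
  ... | inj₂ (t , t≤w , refl) = 8 * g + 7 + t , offset⇒inBox k IV bot-IV≡ top-IV≡ (inj₂ (t , t≤w , refl)) , χ-offset t

  edges-forward : ∀ c u v → BoxEdge k IV c u v → ¬ (c ≡ red × u ≡ 0 × v ≡ bot k IV) →
    BoxEdge (suc k) III c (χ k u) (χ k v)
  edges-forward c u v e allowed with IV-box.boxEdge⇒step e
  ... | inj₁ (t , t′ , st , refl , refl) =
    subst₂ (BoxEdge (suc k) III c) (sym (χ-offset t)) (sym (χ-offset t′)) (III-box.step⇒boxEdge st)
  ... | inj₂ (refl , u≡P₂b , v≡b) = ⊥-elim (allowed (refl , trans u≡P₂b P₂-bot-IV , trans v≡b (sym bot-IV≡)))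

  bot-IV′∉III′ : ¬ InBox (suc k) III (16 * g + 15)
  bot-IV′∉III′ box with inBox⇒offset (suc k) III bot-III′≡ top-III′≡ box
  ... | inj₁ eq           = m+1+n≢0 (16 * g) eq
  ... | inj₂ (t , _ , eq) = <⇒≢ below eq
    where below : 16 * g + 15 < 20 * g + 19 + t
          below = m+o≡n⇒m≤n (4 * g + 3 + t) (solve (g ∷ t ∷ []))

  edges-backward : ∀ c u′ v′ → BoxEdge (suc k) III c u′ v′ →
    Σ ℕ (λ u → Σ ℕ (λ v → BoxEdge k IV c u v × ¬ (c ≡ red × u ≡ 0 × v ≡ bot k IV) × χ k u ≡ u′ × χ k v ≡ v′))
  edges-backward c u′ v′ e@(_ , u′∈III , _) with III-box.boxEdge⇒step e
  ... | inj₁ (t , t′ , st , refl , refl) =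
    8 * g + 7 + t , 8 * g + 7 + t′ , IV-box.step⇒boxEdge st ,
    (λ (_ , u≡0 , _) → m+1+n≢0 (8 * g) (m+n≡0⇒m≡0 (8 * g + 7) u≡0)) , χ-offset t , χ-offset t′
  ... | inj₂ (_ , u′≡P₂b , _) =
    ⊥-elim (bot-IV′∉III′ (subst (InBox (suc k) III) (trans u′≡P₂b P₂-bot-III′) u′∈III))

  red-into-bot-III′ : Edge (suc k) red (bot (suc k) IV) (bot (suc k) III)
  red-into-bot-III′ =
    subst₂ (Edge (suc k) red) (trans P₂-bot-III′ (sym bot-IV′≡)) (sym bot-III′≡) III-box.red-into-bot

  no-red-from-0 : ¬ Edge (suc k) red 0 (bot (suc k) III)
  no-red-from-0 (redE _ _ _ _ 0≡P₂m) =
    m+1+n≢0 (16 * g) (sym (trans 0≡P₂m (trans (cong P₂ bot-III′≡) P₂-bot-III′)))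

  blue-into-bot-III′ : Edge (suc k) blue (top (suc k) IV) (bot (suc k) III)
  blue-into-bot-III′ = blueE _ _
    (subst₂ _≤_ (sym bot-IV′≡) (sym top-IV′≡) lo′≤top)
    (subst₂ _<_ (sym top-IV′≡) (sym hi′≡) top<hi′)
    (trans bot-III′≡ (trans (+-suc (20 * g) 18) (cong suc (sym top-IV′≡))))
    where lo′≤top : 16 * g + 15 ≤ 20 * g + 18
          lo′≤top = m+o≡n⇒m≤n (4 * g + 3) (solve (g ∷ []))
          top<hi′ : 20 * g + 18 < 32 * g + 31
          top<hi′ = m+o≡n⇒m≤n (12 * g + 12) (solve (g ∷ []))

mainTheorem14 : (k : ℕ) → 4 ≤ k →
    -- χ is a bijection from the nodes of B₄ of G_k onto the nodes of B₃ of G_{k+1}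
    ((∀ n → InBox k IV n → InBox (ℕ.suc k) III (χ k n))
    × (∀ m n → InBox k IV m → InBox k IV n → χ k m ≡ χ k n → m ≡ n)
    × (∀ n′ → InBox (ℕ.suc k) III n′ → Σ ℕ (λ n → InBox k IV n × χ k n ≡ n′)))
    -- edges other than the red edge 0 → IV_b^k map to edges of the same colour
    × (∀ c u v → BoxEdge k IV c u v → ¬ (c ≡ red × u ≡ 0 × v ≡ bot k IV) →
         BoxEdge (ℕ.suc k) III c (χ k u) (χ k v))
    -- every edge of B₃ of G_{k+1} arises in this way
    × (∀ c u′ v′ → BoxEdge (ℕ.suc k) III c u′ v′ →
         Σ ℕ (λ u → Σ ℕ (λ v → BoxEdge k IV c u v × ¬ (c ≡ red × u ≡ 0 × v ≡ bot k IV)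
           × χ k u ≡ u′ × χ k v ≡ v′)))
    -- in G_{k+1}: red edge IV_b → III_b (not 0 → III_b), blue edge IV_t → III_b
    × (Edge (ℕ.suc k) red (bot (ℕ.suc k) IV) (bot (ℕ.suc k) III)
    × ¬ Edge (ℕ.suc k) red 0 (bot (ℕ.suc k) III)
    × Edge (ℕ.suc k) blue (top (ℕ.suc k) IV) (bot (ℕ.suc k) III))
mainTheorem14 (suc (suc (suc (suc i)))) (s≤s (s≤s (s≤s (s≤s _)))) with m≤n⇒∃[o]m+o≡n (m^n>0 2 i)
... | g , 1+g≡2^i =
  (χ-maps , (λ m n _ _ → χ-injective k m n) , χ-onto) ,
  edges-forward , edges-backward ,
  red-into-bot-III′ , no-red-from-0 , blue-into-bot-III′
  where open Level i g (sym 1+g≡2^i)
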